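{- For a graph $G$ let $\mathbf{M}[G]\subseteq\mathbf{FL}[G]$ be the span of $\{M_F: F\text{ a matching of }G\}$ (equivalently of $\{P_F:F\text{ a matching}\}$). Then $\mathbf{M}$ is a self-dual, commutative, cocommutative Hopf submonoid of $\mathbf{FL}$.
   Context: All graphs are finite simple graphs over a field $\mathbb{K}$; $G_S$ is the induced subgraph. Hopf monoids are in graphical species (functors from finite graphs with isomorphisms to $\mathbb{K}$-vector spaces) with respect to the Cauchy product $(\mathbf{g}\cdot\mathbf{h})[G]=\bigoplus_{S|T\models V(G)}\mathbf{g}[G_S]\otimes\mathbf{h}[G_T]$ and symmetry $x\otimes y\mapsto y\otimes x$; self-dual means isomorphic as a Hopf monoid to its dual. For $D\subseteq E(G)$, $\pi_D$ is the partition of $V(G)$ into components of $(V(G),D)$; $D$ is a flat if $D=\bigcup_{B\in\pi_D}E(G_B)$. $\mathbf{FL}[G]$ has basis $\{M_F\}$ indexed by flats, product $M_F\otimes M_H\mapsto M_{F\sqcup H}$, coproduct $M_F\mapsto M_{F|_S}\otimes M_{F|_T}$ where $F|_S=\{uv\in F:u,v\in S\}$; its $P$ basis is defined by $M_F=\sum_{F'\subseteq F,\,F'\text{ flat}}P_{F'}$. A matching is a set of edges no two of which share an endpoint (every matching is a flat). -}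

module Defs where

open import Level using (Level; _⊔_) renaming (suc to lsuc)
open import Data.Nat using (ℕ; zero; suc)
open import Data.Fin using (Fin)
open import Data.Bool using (Bool; true; false; _∧_; _∨_; not; if_then_else_)
open import Data.Bool.Properties using (∧-comm)
import Data.Bool as B
open import Data.Vec using (Vec; []; _∷_; lookup; tabulate; replicate)
open import Data.Vec.Properties using (≡-dec)
open import Data.List using (List; []; _∷_; [_]; concatMap; foldr) renaming (map to lmap)
open import Data.Product using (Σ; ∃; _×_; _,_; proj₁; proj₂; swap)
open import Data.Fin.Properties using (all?)
open import Relation.Nullary using (¬_; Dec; yes; no; does)
open import Relation.Nullary.Decidable using (_×-dec_; _→-dec_)
open import Relation.Binary.PropositionalEquality using (_≡_; refl; sym; trans; cong)
open import Relation.Binary.Construct.Closure.ReflexiveTransitive using (Star)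
open import Algebra.Bundles using (CommutativeRing)

record Field (c ℓ : Level) : Set (lsuc (c ⊔ ℓ)) where
  field
    commutativeRing : CommutativeRing c ℓ
  open CommutativeRing commutativeRing public
  field
    0≉1     : ¬ (0# ≈ 1#)
    inverse : ∀ x → ¬ (x ≈ 0#) → ∃ λ y → x * y ≈ 1#

EdgeSet : ℕ → Set
EdgeSet n = Vec (Vec Bool n) n

_⟦_,_⟧ : ∀ {n} → EdgeSet n → Fin n → Fin n → Bool
D ⟦ u , v ⟧ = lookup (lookup D u) v

VSet : ℕ → Set
VSet n = Vec Bool n

_∋_ : ∀ {n} → VSet n → Fin n → Bool
S ∋ u = lookup S u

private
  ∧-true-l : ∀ {x y} → x ∧ y ≡ true → x ≡ true
  ∧-true-l {true} _ = refl
  ∧-true-r : ∀ {x y} → x ∧ y ≡ true → y ≡ true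
  ∧-true-r {true} p = p
  ∧-true-r {false} ()
  both : ∀ {x y} → x ≡ true → y ≡ true → x ∧ y ≡ true
  both refl refl = refl

-- A graph has a finite vertex set V(G), given as a
-- subset of an ambient range Fin n, and a symmetric irreflexive adjacency
-- relation supported on V(G).  (Graphs on arbitrary finite vertex sets are
-- represented up to isomorphism; naturality is imposed w.r.t. all
-- isomorphisms below, also between different ambient ranges.)

record Graph (n : ℕ) : Set where
  field
    vert     : VSet n
    adj      : EdgeSet n
    adj-sym  : ∀ u v → adj ⟦ u , v ⟧ ≡ adj ⟦ v , u ⟧
    adj-irr  : ∀ u → adj ⟦ u , u ⟧ ≡ false
    adj-vert : ∀ u v → adj ⟦ u , v ⟧ ≡ true → vert ∋ u ≡ true
open Graph public

IsEmptyGraph : ∀ {n} → Graph n → Set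
IsEmptyGraph G = ∀ u → vert G ∋ u ≡ false

induced : ∀ {n} → Graph n → VSet n → Graph n
induced G S = record
  { vert     = tabulate (λ u → (S ∋ u) ∧ (vert G ∋ u))
  ; adj      = tabulate (λ u → tabulate (λ v → adj G ⟦ u , v ⟧ ∧ ((S ∋ u) ∧ (S ∋ v))))
  ; adj-sym  = λ u v → prf-sym u v
  ; adj-irr  = λ u → prf-irr u
  ; adj-vert = λ u v p → prf-vert u v p
  }
  where
  open import Data.Vec.Properties using (lookup∘tabulate)
  prf-sym : ∀ u v → lookup (lookup (tabulate (λ u → tabulate (λ v → adj G ⟦ u , v ⟧ ∧ ((S ∋ u) ∧ (S ∋ v))))) u) v
                  ≡ lookup (lookup (tabulate (λ u → tabulate (λ v → adj G ⟦ u , v ⟧ ∧ ((S ∋ u) ∧ (S ∋ v))))) v) u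
  prf-sym u v rewrite lookup∘tabulate (λ u → tabulate (λ v → adj G ⟦ u , v ⟧ ∧ ((S ∋ u) ∧ (S ∋ v)))) u
                    | lookup∘tabulate (λ u → tabulate (λ v → adj G ⟦ u , v ⟧ ∧ ((S ∋ u) ∧ (S ∋ v)))) v
                    | lookup∘tabulate (λ v → adj G ⟦ u , v ⟧ ∧ ((S ∋ u) ∧ (S ∋ v))) v
                    | lookup∘tabulate (λ w → adj G ⟦ v , w ⟧ ∧ ((S ∋ v) ∧ (S ∋ w))) u
                    | adj-sym G u v | ∧-comm (S ∋ u) (S ∋ v) = refl
  prf-irr : ∀ u → lookup (lookup (tabulate (λ u → tabulate (λ v → adj G ⟦ u , v ⟧ ∧ ((S ∋ u) ∧ (S ∋ v))))) u) u ≡ false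
  prf-irr u rewrite lookup∘tabulate (λ u → tabulate (λ v → adj G ⟦ u , v ⟧ ∧ ((S ∋ u) ∧ (S ∋ v)))) u
                  | lookup∘tabulate (λ v → adj G ⟦ u , v ⟧ ∧ ((S ∋ u) ∧ (S ∋ v))) u
                  | adj-irr G u = refl
  prf-vert : ∀ u v → lookup (lookup (tabulate (λ u → tabulate (λ v → adj G ⟦ u , v ⟧ ∧ ((S ∋ u) ∧ (S ∋ v))))) u) v ≡ true
           → lookup (tabulate (λ u → (S ∋ u) ∧ (vert G ∋ u))) u ≡ true
  prf-vert u v p rewrite lookup∘tabulate (λ u → (S ∋ u) ∧ (vert G ∋ u)) u
                       | lookup∘tabulate (λ u → tabulate (λ v → adj G ⟦ u , v ⟧ ∧ ((S ∋ u) ∧ (S ∋ v)))) u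
                       | lookup∘tabulate (λ v → adj G ⟦ u , v ⟧ ∧ ((S ∋ u) ∧ (S ∋ v))) v
    = both (∧-true-l (∧-true-r {adj G ⟦ u , v ⟧} p)) (adj-vert G u v (∧-true-l p))

record Decomp {n} (G : Graph n) : Set where
  field
    S T   : VSet n
    cover : ∀ u → (S ∋ u) ∨ (T ∋ u) ≡ vert G ∋ u
    disj  : ∀ u → (S ∋ u) ∧ (T ∋ u) ≡ false
open Decomp public

swapD : ∀ {n} {G : Graph n} → Decomp G → Decomp G
swapD {G = G} d = record
  { S = T d ; T = S d
  ; cover = λ u → trans (∨-comm (T d ∋ u) (S d ∋ u)) (cover d u)
  ; disj  = λ u → trans (∧-comm (T d ∋ u) (S d ∋ u)) (disj d u) }
  where open Data.Bool.Properties using (∨-comm)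

record Iso {n n'} (G : Graph n) (G' : Graph n') : Set where
  field
    σ        : Fin n → Fin n'
    τ        : Fin n' → Fin n
    σ-vert   : ∀ u → vert G ∋ u ≡ true → vert G' ∋ σ u ≡ true
    τ-vert   : ∀ u' → vert G' ∋ u' ≡ true → vert G ∋ τ u' ≡ true
    τσ       : ∀ u → vert G ∋ u ≡ true → τ (σ u) ≡ u
    στ       : ∀ u' → vert G' ∋ u' ≡ true → σ (τ u') ≡ u'
    adj-pres : ∀ u v → vert G ∋ u ≡ true → vert G ∋ v ≡ true →
               adj G' ⟦ σ u , σ v ⟧ ≡ adj G ⟦ u , v ⟧
open Iso public

IsEdgeSubset : ∀ {n} → Graph n → EdgeSet n → Set
IsEdgeSubset G D = (∀ u v → D ⟦ u , v ⟧ ≡ true → adj G ⟦ u , v ⟧ ≡ true)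
                 × (∀ u v → D ⟦ u , v ⟧ ≡ D ⟦ v , u ⟧)

SameBlock : ∀ {n} → EdgeSet n → Fin n → Fin n → Set
SameBlock D = Star (λ u v → D ⟦ u , v ⟧ ≡ true)

-- D is a flat: D = ⋃_{B ∈ π_D} E(G_B), i.e. every edge of G inside a block
-- of π_D lies in D (the other inclusion holds for every D ⊆ E(G)).
IsFlat : ∀ {n} → Graph n → EdgeSet n → Set
IsFlat G D = IsEdgeSubset G D
           × (∀ u v → adj G ⟦ u , v ⟧ ≡ true → SameBlock D u v → D ⟦ u , v ⟧ ≡ true)

IsMatching : ∀ {n} → Graph n → EdgeSet n → Set
IsMatching G F = IsEdgeSubset G F
               × (∀ u v w → F ⟦ u , v ⟧ ≡ true → F ⟦ u , w ⟧ ≡ true → v ≡ w)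

isMatching? : ∀ {n} (G : Graph n) (F : EdgeSet n) → Dec (IsMatching G F)
isMatching? G F =
  ((all? λ u → all? λ v → (F ⟦ u , v ⟧ B.≟ true) →-dec (adj G ⟦ u , v ⟧ B.≟ true))
   ×-dec (all? λ u → all? λ v → F ⟦ u , v ⟧ B.≟ F ⟦ v , u ⟧))
  ×-dec (all? λ u → all? λ v → all? λ w →
           (F ⟦ u , v ⟧ B.≟ true) →-dec ((F ⟦ u , w ⟧ B.≟ true) →-dec (v Fin≟ w)))
  where open Data.Fin using () renaming (_≟_ to _Fin≟_)

∅ᴱ : ∀ {n} → EdgeSet n
∅ᴱ {n} = replicate n (replicate n false)

-- F ⊔ H  (product M_F ⊗ M_H ↦ M_{F ⊔ H})
_⊔ᴱ_ : ∀ {n} → EdgeSet n → EdgeSet n → EdgeSet n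
F ⊔ᴱ H = tabulate (λ u → tabulate (λ v → F ⟦ u , v ⟧ ∨ H ⟦ u , v ⟧))

-- F|_S = {uv ∈ F : u, v ∈ S}  (coproduct M_F ↦ M_{F|S} ⊗ M_{F|T})
_∣ᴱ_ : ∀ {n} → EdgeSet n → VSet n → EdgeSet n
F ∣ᴱ S = tabulate (λ u → tabulate (λ v → F ⟦ u , v ⟧ ∧ ((S ∋ u) ∧ (S ∋ v))))

-- action of a graph isomorphism on edge sets (M_F ↦ M_{σ(F)})
transport : ∀ {n n'} {G : Graph n} {G' : Graph n'} → Iso G G' → EdgeSet n → EdgeSet n'
transport {G' = G'} i F =
  tabulate (λ u' → tabulate (λ v' →
    ((vert G' ∋ u') ∧ (vert G' ∋ v')) ∧ F ⟦ τ i u' , τ i v' ⟧))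

-- A sub-species of FL spanned by the M_F with P G F, F a flat.
-- It is a Hopf submonoid iff it is closed under the species action, the
-- unit, the product and the coproduct (for connected Hopf monoids closure
-- under the antipode follows; FL is connected).

BasisPred : Set₁
BasisPred = ∀ {n} → Graph n → EdgeSet n → Set

record IsHopfSubmonoidOfFL (P : BasisPred) : Set where
  field
    ⊆flats   : ∀ {n} (G : Graph n) F → P G F → IsFlat G F
    species  : ∀ {n n'} (G : Graph n) (G' : Graph n') (i : Iso G G') F →
               P G F → P G' (transport i F)
    unit     : ∀ {n} (G : Graph n) → IsEmptyGraph G → P G ∅ᴱ
    product  : ∀ {n} (G : Graph n) (d : Decomp G) F H →
               P (induced G (S d)) F → P (induced G (T d)) H → P G (F ⊔ᴱ H)
    coproduct : ∀ {n} (G : Graph n) (d : Decomp G) F → P G F →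
               P (induced G (S d)) (F ∣ᴱ S d) × P (induced G (T d)) (F ∣ᴱ T d)

-- commutativity: μ_{S,T}(M_F ⊗ M_H) = μ_{T,S}(M_H ⊗ M_F)
IsCommutative : BasisPred → Set
IsCommutative P = ∀ {n} (G : Graph n) (d : Decomp G) F H →
  P (induced G (S d)) F → P (induced G (T d)) H → F ⊔ᴱ H ≡ H ⊔ᴱ F

-- cocommutativity: Δ_{T,S}(M_F) = swap (Δ_{S,T}(M_F))
IsCocommutative : BasisPred → Set
IsCocommutative P = ∀ {n} (G : Graph n) (d : Decomp G) F → P G F →
  (F ∣ᴱ S (swapD d) , F ∣ᴱ T (swapD d)) ≡ swap (F ∣ᴱ S d , F ∣ᴱ T d)

-- A morphism φ : M → M* of graphical species is given by its
-- matrix φ G F K = ⟨ φ_G(M_F) , M_K ⟩ (F, K basis labels).  It is an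
-- isomorphism of Hopf monoids iff it is natural, each φ_G is invertible,
-- and it preserves unit/counit, product and coproduct (the dual Hopf
-- monoid M* has product dual to the coproduct of M and vice versa).

allVecs : ∀ {a} {A : Set a} → List A → (n : ℕ) → List (Vec A n)
allVecs xs zero    = [ [] ]
allVecs xs (suc n) = concatMap (λ x → lmap (x ∷_) (allVecs xs n)) xs

allEdgeSets : (n : ℕ) → List (EdgeSet n)
allEdgeSets n = allVecs (allVecs (true ∷ false ∷ []) n) n

module _ {c ℓ} (K : Field c ℓ) where
  open Field K

  sumOver : (P : BasisPred) → (∀ {n} (G : Graph n) F → Dec (P G F)) →
            ∀ {n} → Graph n → (EdgeSet n → Carrier) → Carrier
  sumOver P P? {n} G f =
    foldr (λ F acc → (if does (P? G F) then f F else 0#) + acc) 0# (allEdgeSets n)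

  δ : ∀ {n} → EdgeSet n → EdgeSet n → Carrier
  δ F F' = if does (≡-dec (≡-dec B._≟_) F F') then 1# else 0#

  Matrix : Set c
  Matrix = ∀ {n} → Graph n → EdgeSet n → EdgeSet n → Carrier

  record IsHopfIsoToDual (P : BasisPred) (P? : ∀ {n} (G : Graph n) F → Dec (P G F))
                         (φ : Matrix) : Set (c ⊔ ℓ) where
    field
      natural : ∀ {n n'} (G : Graph n) (G' : Graph n') (i : Iso G G') F K →
                P G F → P G K → φ G' (transport i F) (transport i K) ≈ φ G F K
      invertible : ∃ λ (ψ : Matrix) →
                (∀ {n} (G : Graph n) F F'' → P G F → P G F'' →
                   sumOver P P? G (λ F' → φ G F F' * ψ G F' F'') ≈ δ F F'')
              × (∀ {n} (G : Graph n) F F'' → P G F → P G F'' →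
                   sumOver P P? G (λ F' → ψ G F F' * φ G F' F'') ≈ δ F F'')
      -- unit / counit: φ_∅(M_∅) = 1_{M*} = ε_M
      unit    : ∀ {n} (G : Graph n) → IsEmptyGraph G → φ G ∅ᴱ ∅ᴱ ≈ 1#
      -- φ(M_F · M_H) = φ(M_F) · φ(M_H), paired with M_K
      product : ∀ {n} (G : Graph n) (d : Decomp G) F H K →
                P (induced G (S d)) F → P (induced G (T d)) H → P G K →
                φ G (F ⊔ᴱ H) K ≈
                  φ (induced G (S d)) F (K ∣ᴱ S d) * φ (induced G (T d)) H (K ∣ᴱ T d)
      -- Δ(φ(M_K)) = (φ ⊗ φ)(Δ M_K), paired with M_F ⊗ M_H
      coproduct : ∀ {n} (G : Graph n) (d : Decomp G) K F H →
                P G K → P (induced G (S d)) F → P (induced G (T d)) H →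
                φ G K (F ⊔ᴱ H) ≈
                  φ (induced G (S d)) (K ∣ᴱ S d) F * φ (induced G (T d)) (K ∣ᴱ T d) H

-- Matchings are closed under the structure maps of FL: the union of matchings of G_S and G_T is a
-- matching of G because S and T are disjoint, restrictions and isomorphic images of matchings are
-- matchings, and a matching is a flat because each block of π_F carries at most one edge of F.
-- Commutativity and cocommutativity are inherited from FL.
--
-- For self-duality, pair M_F with M_K by [F ∩ K = ∅]; since F ⊔ H misses K exactly when F misses
-- K|_S and H misses K|_T, this is compatible with product and coproduct.  Its inverse is
-- ψ(F, K) = Σ_{M ⊇ F ∪ K} (-1)^{|M|+|F|+|K|}, the sum over matchings M.  As every subset of a
-- matching is a matching, both inverse laws reduce to Σ_{K ⊆ L ⊆ X} (-1)^{|L|} = [K = X] (-1)^{|K|}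
-- for a matching X, which holds because toggling a fixed edge of X ∖ K reverses the sign.

module Submission where

open import Defs
open import Level using (Level; _⊔_)
open import Data.Nat using (zero; suc)
open import Data.Fin using (Fin; zero; suc; _<_)
open import Data.Fin.Properties using (_≟_; _<?_; <-cmp; <-asym; <-irrefl; suc-injective; all?; ¬∀⟶∃¬)
open import Data.Bool using (Bool; true; false; _∧_; _∨_; not; _xor_; if_then_else_)
open import Data.Bool.Properties
  using (∧-comm; ∧-assoc; ∨-comm; ∧-zeroʳ; ∧-conicalˡ; ∧-conicalʳ; ∨-zeroʳ;
         not-distribˡ-xor; not-distribʳ-xor; xor-identityʳ; xor-same; xor-assoc)
  renaming (_≟_ to _≟ᵇ_)
open import Data.Vec using (lookup; tabulate; replicate; []; _∷_)
open import Data.List using (List; []; _∷_; foldr; _++_; concatMap) renaming (map to mapᴸ)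
open import Data.Vec.Properties using (lookup∘tabulate; tabulate∘lookup; tabulate-cong; lookup-replicate; ≡-dec)
open import Data.Product using (∃; ∃₂; _×_; _,_; proj₁; proj₂; swap)
open import Data.Sum using (_⊎_; inj₁; inj₂; [_,_])
open import Data.Empty using (⊥-elim)
open import Function.Base using (_∘_)
open import Function.Bundles using (_⇔_; mk⇔; module Equivalence)
open import Relation.Nullary using (¬_; Dec; yes; no; does; contradiction)
open import Relation.Nullary.Decidable using (dec-true; dec-false; does-⇔; _×-dec_; _⊎-dec_; _→-dec_; ¬?)
open import Relation.Binary.Definitions using (DecidableEquality; tri<; tri≈; tri>)
open import Relation.Binary.PropositionalEquality
  using (_≡_; _≢_; refl; sym; trans; cong; cong₂; subst; module ≡-Reasoning)
open import Relation.Binary.Construct.Closure.ReflexiveTransitive using (ε; _◅_)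
open import Algebra.Bundles using (CommutativeRing)

from-does : ∀ {a} {A : Set a} (a? : Dec A) → does a? ≡ true → A
from-does (yes a) _ = a

∧-intro : ∀ {x y} → x ≡ true → y ≡ true → x ∧ y ≡ true
∧-intro refl refl = refl

∨-elim : ∀ {x y} → x ∨ y ≡ true → x ≡ true ⊎ y ≡ true
∨-elim {true}  _ = inj₁ refl
∨-elim {false} e = inj₂ e

∨-introˡ : ∀ {x} y → x ≡ true → x ∨ y ≡ true
∨-introˡ y refl = refl

∨-introʳ : ∀ x {y} → y ≡ true → x ∨ y ≡ true
∨-introʳ x refl = ∨-zeroʳ x

lookup-tabulate² : ∀ {n} (f : Fin n → Fin n → Bool) u v → tabulate (λ u → tabulate (f u)) ⟦ u , v ⟧ ≡ f u v
lookup-tabulate² f u v rewrite lookup∘tabulate (λ u → tabulate (f u)) u = lookup∘tabulate (f u) v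

∅ᴱ-lookup : ∀ {n} (u v : Fin n) → ∅ᴱ ⟦ u , v ⟧ ≡ false
∅ᴱ-lookup {n} u v rewrite lookup-replicate u (replicate n false) = lookup-replicate v false

∅ᴱ-empty : ∀ {n} (u v : Fin n) → ∅ᴱ ⟦ u , v ⟧ ≢ true
∅ᴱ-empty u v e with trans (sym (∅ᴱ-lookup u v)) e
... | ()

edgeSet-ext : ∀ {n} {A B : EdgeSet n} → (∀ u v → A ⟦ u , v ⟧ ≡ B ⟦ u , v ⟧) → A ≡ B
edgeSet-ext {A = A} {B} eq = begin
  A                    ≡⟨ tabulate∘lookup A ⟨
  tabulate (lookup A)  ≡⟨ tabulate-cong row-eq ⟩
  tabulate (lookup B)  ≡⟨ tabulate∘lookup B ⟩
  B                    ∎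
  where
  open ≡-Reasoning
  row-eq : ∀ u → lookup A u ≡ lookup B u
  row-eq u = trans (sym (tabulate∘lookup (lookup A u)))
                   (trans (tabulate-cong (eq u)) (tabulate∘lookup (lookup B u)))

infix 4 _≟ᴱ_

_≟ᴱ_ : ∀ {n} → DecidableEquality (EdgeSet n)
_≟ᴱ_ = ≡-dec (≡-dec _≟ᵇ_)

Symmetric : ∀ {n} → EdgeSet n → Set
Symmetric D = ∀ u v → D ⟦ u , v ⟧ ≡ D ⟦ v , u ⟧

∅ᴱ-sym : ∀ {n} → Symmetric (∅ᴱ {n})
∅ᴱ-sym u v = trans (∅ᴱ-lookup u v) (sym (∅ᴱ-lookup v u))

⊔ᴱ-comm : ∀ {n} (F H : EdgeSet n) → F ⊔ᴱ H ≡ H ⊔ᴱ F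
⊔ᴱ-comm F H = edgeSet-ext λ u v →
  trans (lookup-tabulate² _ u v) (trans (∨-comm (F ⟦ u , v ⟧) _) (sym (lookup-tabulate² _ u v)))

⊔ᴱ-lookup : ∀ {n} (F H : EdgeSet n) {u v} → (F ⊔ᴱ H) ⟦ u , v ⟧ ≡ true →
            F ⟦ u , v ⟧ ≡ true ⊎ H ⟦ u , v ⟧ ≡ true
⊔ᴱ-lookup F H {u} {v} e = ∨-elim (trans (sym (lookup-tabulate² _ u v)) e)

infix 4 _⊆ᴱ_ _⊆ᴱ?_

_⊆ᴱ_ : ∀ {n} → EdgeSet n → EdgeSet n → Set
K ⊆ᴱ L = ∀ u v → K ⟦ u , v ⟧ ≡ true → L ⟦ u , v ⟧ ≡ true

⊆ᴱ-at? : ∀ {n} (K L : EdgeSet n) u v → Dec (K ⟦ u , v ⟧ ≡ true → L ⟦ u , v ⟧ ≡ true)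
⊆ᴱ-at? K L u v = (K ⟦ u , v ⟧ ≟ᵇ true) →-dec (L ⟦ u , v ⟧ ≟ᵇ true)

_⊆ᴱ?_ : ∀ {n} (K L : EdgeSet n) → Dec (K ⊆ᴱ L)
K ⊆ᴱ? L = all? λ u → all? (⊆ᴱ-at? K L u)

⊆ᴱ-trans : ∀ {n} {A B C : EdgeSet n} → A ⊆ᴱ B → B ⊆ᴱ C → A ⊆ᴱ C
⊆ᴱ-trans A⊆B B⊆C u v = B⊆C u v ∘ A⊆B u v

⊆ᴱ-antisym : ∀ {n} {A B : EdgeSet n} → A ⊆ᴱ B → B ⊆ᴱ A → A ≡ B
⊆ᴱ-antisym {A = A} {B} A⊆B B⊆A = edgeSet-ext λ u v → entry (A⊆B u v) (B⊆A u v)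
  where
  entry : ∀ {x y} → (x ≡ true → y ≡ true) → (y ≡ true → x ≡ true) → x ≡ y
  entry {true}  to _    = sym (to refl)
  entry {false} {true}  _ from = from refl
  entry {false} {false} _ _    = refl

∅ᴱ-⊆ᴱ : ∀ {n} {L : EdgeSet n} → ∅ᴱ ⊆ᴱ L
∅ᴱ-⊆ᴱ u v e = ⊥-elim (∅ᴱ-empty u v e)

¬⊆ᴱ⇒witness : ∀ {n} {K L : EdgeSet n} → ¬ K ⊆ᴱ L → ∃₂ λ u v → K ⟦ u , v ⟧ ≡ true × L ⟦ u , v ⟧ ≡ false
¬⊆ᴱ⇒witness {n} {K} {L} K⊈L
  with u , row⊈   ← ¬∀⟶∃¬ n _ (λ u → all? (⊆ᴱ-at? K L u)) K⊈L
  with v , entry⊈ ← ¬∀⟶∃¬ n _ (⊆ᴱ-at? K L u) row⊈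
  = u , v , entry entry⊈
  where
  entry : ∀ {x y} → ¬ (x ≡ true → y ≡ true) → x ≡ true × y ≡ false
  entry {true}  {false} _ = refl , refl
  entry {true}  {true}  h = contradiction (λ _ → refl) h
  entry {false}         h = contradiction (λ ()) h

Disjointᴱ : ∀ {n} → EdgeSet n → EdgeSet n → Set
Disjointᴱ F K = ∀ u v → F ⟦ u , v ⟧ ≡ true → K ⟦ u , v ⟧ ≢ true

disjointᴱ? : ∀ {n} (F K : EdgeSet n) → Dec (Disjointᴱ F K)
disjointᴱ? F K = all? λ u → all? λ v → (F ⟦ u , v ⟧ ≟ᵇ true) →-dec ¬? (K ⟦ u , v ⟧ ≟ᵇ true)

Disjointᴱ-sym : ∀ {n} {F K : EdgeSet n} → Disjointᴱ F K → Disjointᴱ K F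
Disjointᴱ-sym F∩K=∅ u v k f = F∩K=∅ u v f k

_∖ᴱ_ : ∀ {n} → EdgeSet n → EdgeSet n → EdgeSet n
M ∖ᴱ F = tabulate (λ u → tabulate (λ v → M ⟦ u , v ⟧ ∧ not (F ⟦ u , v ⟧)))

∖ᴱ-true : ∀ {n} (M F : EdgeSet n) u v →
          (M ∖ᴱ F) ⟦ u , v ⟧ ≡ true ⇔ (M ⟦ u , v ⟧ ≡ true × F ⟦ u , v ⟧ ≢ true)
∖ᴱ-true M F u v rewrite lookup-tabulate² (λ u v → M ⟦ u , v ⟧ ∧ not (F ⟦ u , v ⟧)) u v =
  mk⇔ to from
  where
  to : ∀ {x y} → x ∧ not y ≡ true → x ≡ true × y ≢ true
  to {true} {false} _ = refl , λ ()
  from : ∀ {x y} → x ≡ true × y ≢ true → x ∧ not y ≡ true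
  from {y = false} (refl , _)  = refl
  from {y = true}  (_ , y≢true) = contradiction refl y≢true

∖ᴱ-⊆ᴱ : ∀ {n} {M F : EdgeSet n} → M ∖ᴱ F ⊆ᴱ M
∖ᴱ-⊆ᴱ {M = M} {F} u v = proj₁ ∘ Equivalence.to (∖ᴱ-true M F u v)

∖ᴱ-sym : ∀ {n} {M F : EdgeSet n} → Symmetric M → Symmetric F → Symmetric (M ∖ᴱ F)
∖ᴱ-sym {M = M} {F} symM symF u v =
  trans (lookup-tabulate² _ u v)
        (trans (cong₂ (λ x y → x ∧ not y) (symM u v) (symF u v)) (sym (lookup-tabulate² _ v u)))

⊆ᴱ-∖ᴱ⇔ : ∀ {n} {F L M : EdgeSet n} → (Disjointᴱ F L × L ⊆ᴱ M) ⇔ L ⊆ᴱ M ∖ᴱ F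
⊆ᴱ-∖ᴱ⇔ {F = F} {L} {M} = mk⇔
  (λ (F∩L=∅ , L⊆M) u v l → Equivalence.from (∖ᴱ-true M F u v) (L⊆M u v l , λ f → F∩L=∅ u v f l))
  (λ L⊆M∖F → (λ u v f l → proj₂ (Equivalence.to (∖ᴱ-true M F u v) (L⊆M∖F u v l)) f)
            , ⊆ᴱ-trans {A = L} {M ∖ᴱ F} {M} L⊆M∖F (∖ᴱ-⊆ᴱ {M = M} {F}))

∅ᴱ≡∖ᴱ⇔⊆ᴱ : ∀ {n} {M F : EdgeSet n} → (∅ᴱ ≡ M ∖ᴱ F) ⇔ M ⊆ᴱ F
∅ᴱ≡∖ᴱ⇔⊆ᴱ {M = M} {F} = mk⇔ to from
  where
  to : ∅ᴱ ≡ M ∖ᴱ F → M ⊆ᴱ F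
  to ∅≡M∖F u v m with F ⟦ u , v ⟧ ≟ᵇ true
  ... | yes f = f
  ... | no ¬f = ⊥-elim (∅ᴱ-empty u v
    (trans (cong (λ A → A ⟦ u , v ⟧) ∅≡M∖F) (Equivalence.from (∖ᴱ-true M F u v) (m , ¬f))))
  from : M ⊆ᴱ F → ∅ᴱ ≡ M ∖ᴱ F
  from M⊆F = ⊆ᴱ-antisym {A = ∅ᴱ} {M ∖ᴱ F} (∅ᴱ-⊆ᴱ {L = M ∖ᴱ F}) λ u v e →
    let (m , ¬f) = Equivalence.to (∖ᴱ-true M F u v) e in contradiction (M⊆F u v m) ¬f

infixl 6 _⊕ᴱ_

_⊕ᴱ_ : ∀ {n} → EdgeSet n → EdgeSet n → EdgeSet n
L ⊕ᴱ E = tabulate (λ u → tabulate (λ v → L ⟦ u , v ⟧ xor E ⟦ u , v ⟧))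

⊕ᴱ-lookup-off : ∀ {n} (L E : EdgeSet n) {u v} → E ⟦ u , v ⟧ ≡ false →
                (L ⊕ᴱ E) ⟦ u , v ⟧ ≡ L ⟦ u , v ⟧
⊕ᴱ-lookup-off L E {u} {v} e =
  trans (lookup-tabulate² _ u v) (trans (cong (L ⟦ u , v ⟧ xor_) e) (xor-identityʳ (L ⟦ u , v ⟧)))

⊕ᴱ-lookup-on : ∀ {n} (L E : EdgeSet n) {u v} → E ⟦ u , v ⟧ ≡ true →
               (L ⊕ᴱ E) ⟦ u , v ⟧ ≡ not (L ⟦ u , v ⟧)
⊕ᴱ-lookup-on L E {u} {v} e =
  trans (lookup-tabulate² _ u v) (trans (cong (L ⟦ u , v ⟧ xor_) e) x⊕true≡¬x)
  where
  x⊕true≡¬x = trans (sym (not-distribʳ-xor (L ⟦ u , v ⟧) false)) (cong not (xor-identityʳ (L ⟦ u , v ⟧)))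

⊕ᴱ-involutive : ∀ {n} (L E : EdgeSet n) → L ⊕ᴱ E ⊕ᴱ E ≡ L
⊕ᴱ-involutive L E = edgeSet-ext λ u v → begin
  (L ⊕ᴱ E ⊕ᴱ E) ⟦ u , v ⟧                       ≡⟨ lookup-tabulate² _ u v ⟩
  (L ⊕ᴱ E) ⟦ u , v ⟧ xor E ⟦ u , v ⟧            ≡⟨ cong (_xor E ⟦ u , v ⟧) (lookup-tabulate² _ u v) ⟩
  (L ⟦ u , v ⟧ xor E ⟦ u , v ⟧) xor E ⟦ u , v ⟧  ≡⟨ xor-assoc (L ⟦ u , v ⟧) _ _ ⟩
  L ⟦ u , v ⟧ xor (E ⟦ u , v ⟧ xor E ⟦ u , v ⟧)  ≡⟨ cong (L ⟦ u , v ⟧ xor_) (xor-same (E ⟦ u , v ⟧)) ⟩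
  L ⟦ u , v ⟧ xor false                          ≡⟨ xor-identityʳ (L ⟦ u , v ⟧) ⟩
  L ⟦ u , v ⟧                                    ∎
  where open ≡-Reasoning

⊕ᴱ-sym : ∀ {n} {L E : EdgeSet n} → Symmetric L → Symmetric E → Symmetric (L ⊕ᴱ E)
⊕ᴱ-sym symL symE u v =
  trans (lookup-tabulate² _ u v) (trans (cong₂ _xor_ (symL u v) (symE u v)) (sym (lookup-tabulate² _ v u)))

⊕ᴱ-⊆ᴱ : ∀ {n} {L E X : EdgeSet n} → L ⊆ᴱ X → E ⊆ᴱ X → L ⊕ᴱ E ⊆ᴱ X
⊕ᴱ-⊆ᴱ {L = L} {E} L⊆X E⊆X u v l⊕e with E ⟦ u , v ⟧ in e
... | true  = E⊆X u v e
... | false = L⊆X u v (trans (sym (⊕ᴱ-lookup-off L E e)) l⊕e)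

⊆ᴱ-⊕ᴱ : ∀ {n} {K L E : EdgeSet n} → K ⊆ᴱ L → Disjointᴱ K E → K ⊆ᴱ L ⊕ᴱ E
⊆ᴱ-⊕ᴱ {L = L} {E} K⊆L K∩E=∅ u v k with E ⟦ u , v ⟧ in e
... | true  = contradiction e (K∩E=∅ u v k)
... | false = trans (⊕ᴱ-lookup-off L E e) (K⊆L u v k)

isPair? : ∀ {n} (a b u v : Fin n) → Dec ((u ≡ a × v ≡ b) ⊎ (u ≡ b × v ≡ a))
isPair? a b u v = (u ≟ a ×-dec v ≟ b) ⊎-dec (u ≟ b ×-dec v ≟ a)

pairᴱ : ∀ {n} → Fin n → Fin n → EdgeSet n
pairᴱ a b = tabulate (λ u → tabulate (λ v → does (isPair? a b u v)))

module _ {n} {a b : Fin n} where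

  pairᴱ-lookup : ∀ {u v} → pairᴱ a b ⟦ u , v ⟧ ≡ true → (u ≡ a × v ≡ b) ⊎ (u ≡ b × v ≡ a)
  pairᴱ-lookup {u} {v} e = from-does (isPair? a b u v) (trans (sym (lookup-tabulate² _ u v)) e)

  pairᴱ-off : ∀ {u v} → ¬ (u ≡ a × v ≡ b) → ¬ (u ≡ b × v ≡ a) → pairᴱ a b ⟦ u , v ⟧ ≡ false
  pairᴱ-off {u} {v} ¬ab ¬ba = trans (lookup-tabulate² _ u v) (dec-false (isPair? a b u v) [ ¬ab , ¬ba ])

  pairᴱ-ab : pairᴱ a b ⟦ a , b ⟧ ≡ true
  pairᴱ-ab = trans (lookup-tabulate² _ a b) (dec-true (isPair? a b a b) (inj₁ (refl , refl)))

  pairᴱ-elim : (P : Fin n → Fin n → Set) → P a b → P b a → ∀ {u v} → pairᴱ a b ⟦ u , v ⟧ ≡ true → P u v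
  pairᴱ-elim P pab pba e with pairᴱ-lookup e
  ... | inj₁ (refl , refl) = pab
  ... | inj₂ (refl , refl) = pba

  pairᴱ-sym : Symmetric (pairᴱ a b)
  pairᴱ-sym u v = trans (lookup-tabulate² _ u v)
    (trans (does-⇔ swap-pair (isPair? a b u v) (isPair? a b v u)) (sym (lookup-tabulate² _ v u)))
    where
    flip : ∀ {x y} → (x ≡ a × y ≡ b) ⊎ (x ≡ b × y ≡ a) → (y ≡ a × x ≡ b) ⊎ (y ≡ b × x ≡ a)
    flip (inj₁ (p , q)) = inj₂ (q , p)
    flip (inj₂ (p , q)) = inj₁ (q , p)
    swap-pair : ((u ≡ a × v ≡ b) ⊎ (u ≡ b × v ≡ a)) ⇔ ((v ≡ a × u ≡ b) ⊎ (v ≡ b × u ≡ a))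
    swap-pair = mk⇔ flip flip

  pairᴱ-⊆ᴱ : ∀ {X : EdgeSet n} → Symmetric X → X ⟦ a , b ⟧ ≡ true → pairᴱ a b ⊆ᴱ X
  pairᴱ-⊆ᴱ {X} symX xab u v = pairᴱ-elim (λ u v → X ⟦ u , v ⟧ ≡ true) xab (trans (symX b a) xab)

  pairᴱ-disjoint : ∀ {K : EdgeSet n} → Symmetric K → K ⟦ a , b ⟧ ≡ false → Disjointᴱ K (pairᴱ a b)
  pairᴱ-disjoint {K} symK kab u v k e =
    contradiction (trans (sym k) (pairᴱ-elim (λ u v → K ⟦ u , v ⟧ ≡ false) kab (trans (symK b a) kab) e)) λ ()

parityᶠ : ∀ n → (Fin n → Bool) → Bool
parityᶠ zero    f = false
parityᶠ (suc n) f = f zero xor parityᶠ n (f ∘ suc)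

parityᶠ-cong : ∀ n {f g : Fin n → Bool} → (∀ i → f i ≡ g i) → parityᶠ n f ≡ parityᶠ n g
parityᶠ-cong zero    eq = refl
parityᶠ-cong (suc n) eq = cong₂ _xor_ (eq zero) (parityᶠ-cong n (eq ∘ suc))

parityᶠ-false : ∀ n → parityᶠ n (λ _ → false) ≡ false
parityᶠ-false zero    = refl
parityᶠ-false (suc n) = parityᶠ-false n

parityᶠ-flip : ∀ n {f g : Fin n → Bool} (a : Fin n) → (∀ i → i ≢ a → f i ≡ g i) → g a ≡ not (f a) →
               parityᶠ n g ≡ not (parityᶠ n f)
parityᶠ-flip (suc n) {f} zero eq ga =
  trans (cong₂ _xor_ ga (sym (parityᶠ-cong n λ i → eq (suc i) λ ())))
        (sym (not-distribˡ-xor (f zero) _))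
parityᶠ-flip (suc n) {f} (suc a) eq ga =
  trans (cong₂ _xor_ (sym (eq zero λ ()))
                     (parityᶠ-flip n a (λ i i≢a → eq (suc i) (i≢a ∘ suc-injective)) ga))
        (sym (not-distribʳ-xor (f zero) _))

parityᴱ : ∀ {n} → EdgeSet n → Bool
parityᴱ {n} L = parityᶠ n λ u → parityᶠ n λ v → does (u <? v) ∧ L ⟦ u , v ⟧

parityᴱ-∅ᴱ : ∀ {n} → parityᴱ (∅ᴱ {n}) ≡ false
parityᴱ-∅ᴱ {n} =
  trans (parityᶠ-cong n λ u → trans (parityᶠ-cong n λ v → entry u v) (parityᶠ-false n)) (parityᶠ-false n)
  where
  entry : ∀ u v → does (u <? v) ∧ ∅ᴱ ⟦ u , v ⟧ ≡ false
  entry u v = trans (cong (does (u <? v) ∧_) (∅ᴱ-lookup u v)) (∧-zeroʳ _)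

parityᴱ-⊕ᴱ-pairᴱ : ∀ {n} {a b : Fin n} (L : EdgeSet n) → a < b →
                   parityᴱ (L ⊕ᴱ pairᴱ a b) ≡ not (parityᴱ L)
parityᴱ-⊕ᴱ-pairᴱ {n} {a} {b} L a<b = parityᶠ-flip n a other-row row-a
  where
  E = pairᴱ a b
  entry : Fin n → Fin n → EdgeSet n → Bool
  entry u v X = does (u <? v) ∧ X ⟦ u , v ⟧
  other-row : ∀ u → u ≢ a → parityᶠ n (λ v → entry u v L) ≡ parityᶠ n (λ v → entry u v (L ⊕ᴱ E))
  other-row u u≢a = parityᶠ-cong n column
    where
    column : ∀ v → entry u v L ≡ entry u v (L ⊕ᴱ E)
    column v with E ⟦ u , v ⟧ in e
    ... | false = cong (does (u <? v) ∧_) (sym (⊕ᴱ-lookup-off L E e))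
    ... | true with pairᴱ-lookup e
    ...   | inj₁ (u≡a , _) = contradiction u≡a u≢a
    ...   | inj₂ (refl , refl) rewrite dec-false (b <? a) (<-asym a<b) = refl
  row-a : parityᶠ n (λ v → entry a v (L ⊕ᴱ E)) ≡ not (parityᶠ n (λ v → entry a v L))
  row-a = parityᶠ-flip n b other-column column-b
    where
    other-column : ∀ v → v ≢ b → entry a v L ≡ entry a v (L ⊕ᴱ E)
    other-column v v≢b = cong (does (a <? v) ∧_) (sym (⊕ᴱ-lookup-off L E E-off))
      where E-off = pairᴱ-off {a = a} {b} (v≢b ∘ proj₂) λ (a≡b , _) → <-irrefl a≡b a<b
    column-b : entry a b (L ⊕ᴱ E) ≡ not (entry a b L)
    column-b rewrite dec-true (a <? b) a<b = ⊕ᴱ-lookup-on L E (pairᴱ-ab {a = a} {b})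

edge-vertices : ∀ {n} (G : Graph n) {u v} → adj G ⟦ u , v ⟧ ≡ true → vert G ∋ u ≡ true × vert G ∋ v ≡ true
edge-vertices G {u} {v} uv = adj-vert G u v uv , adj-vert G v u (trans (adj-sym G v u) uv)

module _ {n} (G : Graph n) where

  ⊆ᴱ-matching : ∀ {X L} → IsMatching G X → L ⊆ᴱ X → Symmetric L → IsMatching G L
  ⊆ᴱ-matching ((X⊆G , _) , X-unique) L⊆X symL =
    ((λ u v → X⊆G u v ∘ L⊆X u v) , symL) , λ u v w e e′ → X-unique u v w (L⊆X u v e) (L⊆X u w e′)

  ∅ᴱ-matching : IsMatching G ∅ᴱ
  ∅ᴱ-matching = ((λ u v e → ⊥-elim (∅ᴱ-empty u v e)) , ∅ᴱ-sym) , λ u v w e → ⊥-elim (∅ᴱ-empty u v e)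

  matching-sameBlock : ∀ {F} → IsMatching G F → ∀ {u v} → SameBlock F u v → u ≡ v ⊎ F ⟦ u , v ⟧ ≡ true
  matching-sameBlock mF ε = inj₁ refl
  matching-sameBlock {F} mF@((_ , symF) , F-unique) {u} (_◅_ {j = x} e path) with matching-sameBlock {F} mF path
  ... | inj₁ refl = inj₂ e
  ... | inj₂ e′   = inj₁ (F-unique x u _ (trans (symF x u) e) e′)

  matching⇒flat : ∀ F → IsMatching G F → IsFlat G F
  matching⇒flat F mF = proj₁ mF , edge-in-block
    where
    edge-in-block : ∀ u v → adj G ⟦ u , v ⟧ ≡ true → SameBlock F u v → F ⟦ u , v ⟧ ≡ true
    edge-in-block u v uv path with matching-sameBlock {F} mF path
    ... | inj₁ refl = contradiction (trans (sym (adj-irr G u)) uv) λ ()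
    ... | inj₂ e    = e

  induced-edge : ∀ S {u v} → adj (induced G S) ⟦ u , v ⟧ ≡ true →
                 adj G ⟦ u , v ⟧ ≡ true × S ∋ u ≡ true × S ∋ v ≡ true
  induced-edge S {u} {v} e =
    let e′ = trans (sym (lookup-tabulate² _ u v)) e
        s  = ∧-conicalʳ (adj G ⟦ u , v ⟧) _ e′
    in ∧-conicalˡ _ _ e′ , ∧-conicalˡ (S ∋ u) _ s , ∧-conicalʳ (S ∋ u) _ s

  ⊔ᴱ-matching : ∀ (d : Decomp G) F H → IsMatching (induced G (S d)) F → IsMatching (induced G (T d)) H →
                IsMatching G (F ⊔ᴱ H)
  ⊔ᴱ-matching d F H ((F⊆G_S , symF) , F-unique) ((H⊆G_T , symH) , H-unique) =
    ((F⊔H⊆G , symF⊔H) , F⊔H-unique)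
    where
    F⊔H⊆G : F ⊔ᴱ H ⊆ᴱ adj G
    F⊔H⊆G u v e with ⊔ᴱ-lookup F H e
    ... | inj₁ f = proj₁ (induced-edge (S d) (F⊆G_S u v f))
    ... | inj₂ h = proj₁ (induced-edge (T d) (H⊆G_T u v h))
    symF⊔H : Symmetric (F ⊔ᴱ H)
    symF⊔H u v = trans (lookup-tabulate² _ u v)
      (trans (cong₂ _∨_ (symF u v) (symH u v)) (sym (lookup-tabulate² _ v u)))
    no-shared-endpoint : ∀ u v w → F ⟦ u , v ⟧ ≡ true → H ⟦ u , w ⟧ ≡ true → v ≡ w
    no-shared-endpoint u v w f h
      with (_ , u∈S , _) ← induced-edge (S d) (F⊆G_S u v f)
         | (_ , u∈T , _) ← induced-edge (T d) (H⊆G_T u w h)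
      with () ← trans (sym (disj d u)) (∧-intro u∈S u∈T)
    F⊔H-unique : ∀ u v w → (F ⊔ᴱ H) ⟦ u , v ⟧ ≡ true → (F ⊔ᴱ H) ⟦ u , w ⟧ ≡ true → v ≡ w
    F⊔H-unique u v w e e′ with ⊔ᴱ-lookup F H e | ⊔ᴱ-lookup F H e′
    ... | inj₁ f | inj₁ f′ = F-unique u v w f f′
    ... | inj₂ h | inj₂ h′ = H-unique u v w h h′
    ... | inj₁ f | inj₂ h′ = no-shared-endpoint u v w f h′
    ... | inj₂ h | inj₁ f′ = sym (no-shared-endpoint u w v f′ h)

  ∣ᴱ-matching : ∀ S F → IsMatching G F → IsMatching (induced G S) (F ∣ᴱ S)
  ∣ᴱ-matching S F ((F⊆G , symF) , F-unique) =
    ((F∣S⊆G_S , symF∣S) , λ u v w e e′ → F-unique u v w (edge e) (edge e′))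
    where
    edge : ∀ {u v} → (F ∣ᴱ S) ⟦ u , v ⟧ ≡ true → F ⟦ u , v ⟧ ≡ true
    edge {u} {v} e = ∧-conicalˡ (F ⟦ u , v ⟧) _ (trans (sym (lookup-tabulate² _ u v)) e)
    F∣S⊆G_S : F ∣ᴱ S ⊆ᴱ adj (induced G S)
    F∣S⊆G_S u v e = trans (lookup-tabulate² _ u v)
      (∧-intro (F⊆G u v (edge e)) (∧-conicalʳ (F ⟦ u , v ⟧) _ (trans (sym (lookup-tabulate² _ u v)) e)))
    symF∣S : Symmetric (F ∣ᴱ S)
    symF∣S u v = trans (lookup-tabulate² _ u v)
      (trans (cong₂ _∧_ (symF u v) (∧-comm (S ∋ u) (S ∋ v))) (sym (lookup-tabulate² _ v u)))

Between : ∀ {n} → Graph n → EdgeSet n → EdgeSet n → EdgeSet n → Set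
Between G K X L = IsMatching G L × K ⊆ᴱ L × L ⊆ᴱ X

between? : ∀ {n} (G : Graph n) K X L → Dec (Between G K X L)
between? G K X L = isMatching? G L ×-dec (K ⊆ᴱ? L ×-dec L ⊆ᴱ? X)

Between-⊕ᴱ : ∀ {n} (G : Graph n) {K X E L : EdgeSet n} →
             IsMatching G X → E ⊆ᴱ X → Symmetric E → Disjointᴱ K E →
             Between G K X L → Between G K X (L ⊕ᴱ E)
Between-⊕ᴱ G {K} {X} {E} {L} mX E⊆X symE K∩E=∅ (((_ , symL) , _) , K⊆L , L⊆X) =
    ⊆ᴱ-matching G {X} {L ⊕ᴱ E} mX L⊕E⊆X (⊕ᴱ-sym {L = L} {E} symL symE)
  , ⊆ᴱ-⊕ᴱ {K = K} {L} {E} K⊆L K∩E=∅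
  , L⊕E⊆X
  where
  L⊕E⊆X = ⊕ᴱ-⊆ᴱ {L = L} {E} {X} L⊆X E⊆X

module _ {n n′} {G : Graph n} {G′ : Graph n′} (i : Iso G G′) where

  transport-true : ∀ F {u′ v′} → transport i F ⟦ u′ , v′ ⟧ ≡ true →
                   vert G′ ∋ u′ ≡ true × vert G′ ∋ v′ ≡ true × F ⟦ τ i u′ , τ i v′ ⟧ ≡ true
  transport-true F {u′} {v′} e =
    let e′ = trans (sym (lookup-tabulate² _ u′ v′)) e
        vs = ∧-conicalˡ _ _ e′
    in ∧-conicalˡ _ _ vs , ∧-conicalʳ _ _ vs , ∧-conicalʳ _ _ e′

  transport-σ : ∀ F {u v} → vert G ∋ u ≡ true → vert G ∋ v ≡ true → F ⟦ u , v ⟧ ≡ true →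
                transport i F ⟦ σ i u , σ i v ⟧ ≡ true
  transport-σ F {u} {v} u∈G v∈G e
    rewrite lookup-tabulate² (λ u′ v′ → ((vert G′ ∋ u′) ∧ (vert G′ ∋ v′)) ∧ F ⟦ τ i u′ , τ i v′ ⟧)
                             (σ i u) (σ i v)
          | σ-vert i u u∈G | σ-vert i v v∈G | τσ i u u∈G | τσ i v v∈G = e

  transport-matching : ∀ F → IsMatching G F → IsMatching G′ (transport i F)
  transport-matching F ((F⊆G , symF) , F-unique) = ((tF⊆G′ , symtF) , tF-unique)
    where
    tF⊆G′ : transport i F ⊆ᴱ adj G′
    tF⊆G′ u′ v′ e with transport-true F e
    ... | u′∈G′ , v′∈G′ , f = begin
      adj G′ ⟦ u′ , v′ ⟧
        ≡⟨ cong₂ (λ x y → adj G′ ⟦ x , y ⟧) (στ i u′ u′∈G′) (στ i v′ v′∈G′) ⟨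
      adj G′ ⟦ σ i (τ i u′) , σ i (τ i v′) ⟧
        ≡⟨ adj-pres i _ _ (τ-vert i u′ u′∈G′) (τ-vert i v′ v′∈G′) ⟩
      adj G ⟦ τ i u′ , τ i v′ ⟧
        ≡⟨ F⊆G _ _ f ⟩
      true ∎
      where open ≡-Reasoning
    symtF : Symmetric (transport i F)
    symtF u′ v′ = trans (lookup-tabulate² _ u′ v′)
      (trans (cong₂ _∧_ (∧-comm (vert G′ ∋ u′) _) (symF _ _)) (sym (lookup-tabulate² _ v′ u′)))
    tF-unique : ∀ u′ v′ w′ → transport i F ⟦ u′ , v′ ⟧ ≡ true → transport i F ⟦ u′ , w′ ⟧ ≡ true →
                v′ ≡ w′
    tF-unique u′ v′ w′ e e′ with transport-true F e | transport-true F e′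
    ... | _ , v′∈G′ , f | _ , w′∈G′ , f′ =
      trans (sym (στ i v′ v′∈G′)) (trans (cong (σ i) (F-unique _ _ _ f f′)) (στ i w′ w′∈G′))

  transport-disjoint⇔ : ∀ {F K} → F ⊆ᴱ adj G → Disjointᴱ (transport i F) (transport i K) ⇔ Disjointᴱ F K
  transport-disjoint⇔ {F} {K} F⊆G = mk⇔ to from
    where
    to : Disjointᴱ (transport i F) (transport i K) → Disjointᴱ F K
    to tF∩tK=∅ u v f k =
      let (u∈G , v∈G) = edge-vertices G (F⊆G u v f)
      in tF∩tK=∅ (σ i u) (σ i v) (transport-σ F u∈G v∈G f) (transport-σ K u∈G v∈G k)
    from : Disjointᴱ F K → Disjointᴱ (transport i F) (transport i K)
    from F∩K=∅ u′ v′ f k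
      with (_ , _ , f′) ← transport-true F f | (_ , _ , k′) ← transport-true K k = F∩K=∅ _ _ f′ k′

matchings-hopfSubmonoid : IsHopfSubmonoidOfFL IsMatching
matchings-hopfSubmonoid = record
  { ⊆flats    = matching⇒flat
  ; species   = λ G G′ i → transport-matching i
  ; unit      = λ G _ → ∅ᴱ-matching G
  ; product   = ⊔ᴱ-matching
  ; coproduct = λ G d F mF → ∣ᴱ-matching G (S d) F mF , ∣ᴱ-matching G (T d) F mF
  }

⊔ᴱ-disjoint⇔ : ∀ {n} (G : Graph n) {S T} {F H K : EdgeSet n} →
               F ⊆ᴱ adj (induced G S) → H ⊆ᴱ adj (induced G T) →
               Disjointᴱ (F ⊔ᴱ H) K ⇔ (Disjointᴱ F (K ∣ᴱ S) × Disjointᴱ H (K ∣ᴱ T))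
⊔ᴱ-disjoint⇔ G {S} {T} {F} {H} {K} F⊆G_S H⊆G_T = mk⇔ to from
  where
  in-⊔ᴱ : ∀ {u v} → F ⟦ u , v ⟧ ≡ true ⊎ H ⟦ u , v ⟧ ≡ true → (F ⊔ᴱ H) ⟦ u , v ⟧ ≡ true
  in-⊔ᴱ {u} {v} (inj₁ f) = trans (lookup-tabulate² _ u v) (∨-introˡ _ f)
  in-⊔ᴱ {u} {v} (inj₂ h) = trans (lookup-tabulate² _ u v) (∨-introʳ _ h)
  restricted : ∀ {X} V → X ⊆ᴱ adj (induced G V) →
               ∀ {u v} → X ⟦ u , v ⟧ ≡ true → K ⟦ u , v ⟧ ≡ true → (K ∣ᴱ V) ⟦ u , v ⟧ ≡ true
  restricted V X⊆G_V {u} {v} x k =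
    let (_ , u∈V , v∈V) = induced-edge G V (X⊆G_V u v x)
    in trans (lookup-tabulate² _ u v) (∧-intro k (∧-intro u∈V v∈V))
  unrestricted : ∀ {V u v} → (K ∣ᴱ V) ⟦ u , v ⟧ ≡ true → K ⟦ u , v ⟧ ≡ true
  unrestricted {u = u} {v} e = ∧-conicalˡ (K ⟦ u , v ⟧) _ (trans (sym (lookup-tabulate² _ u v)) e)
  to : Disjointᴱ (F ⊔ᴱ H) K → Disjointᴱ F (K ∣ᴱ S) × Disjointᴱ H (K ∣ᴱ T)
  to F⊔H∩K=∅ = (λ u v f k → F⊔H∩K=∅ u v (in-⊔ᴱ (inj₁ f)) (unrestricted {S} k))
              , (λ u v h k → F⊔H∩K=∅ u v (in-⊔ᴱ (inj₂ h)) (unrestricted {T} k))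
  from : Disjointᴱ F (K ∣ᴱ S) × Disjointᴱ H (K ∣ᴱ T) → Disjointᴱ (F ⊔ᴱ H) K
  from (F∩K=∅ , H∩K=∅) u v e k with ⊔ᴱ-lookup F H e
  ... | inj₁ f = F∩K=∅ u v f (restricted {F} S F⊆G_S f k)
  ... | inj₂ h = H∩K=∅ u v h (restricted {H} T H⊆G_T h k)

module ListSum {c ℓ} (R : CommutativeRing c ℓ) where

  open CommutativeRing R renaming (refl to ≈-refl; sym to ≈-sym; trans to ≈-trans; reflexive to ≈-reflexive)
  open import Algebra.Properties.Ring ring using (-0#≈0#; -‿+-comm)
  open import Algebra.Properties.CommutativeSemigroup +-commutativeSemigroup using (interchange)
  open import Relation.Binary.Reasoning.Setoid setoid

  private variable
    a b : Level
    A : Set a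
    B : Set b

  ∑ : List A → (A → Carrier) → Carrier
  ∑ xs f = foldr (λ x acc → f x + acc) 0# xs

  𝟙[_]_ : Bool → Carrier → Carrier
  𝟙[ b ] x = if b then x else 0#

  ∑-cong : ∀ (xs : List A) {f g : A → Carrier} → (∀ x → f x ≈ g x) → ∑ xs f ≈ ∑ xs g
  ∑-cong []       eq = ≈-refl
  ∑-cong (x ∷ xs) eq = +-cong (eq x) (∑-cong xs eq)

  ∑-zero : ∀ (xs : List A) → ∑ xs (λ _ → 0#) ≈ 0#
  ∑-zero []       = ≈-refl
  ∑-zero (x ∷ xs) = ≈-trans (+-identityˡ _) (∑-zero xs)

  ∑-+ : ∀ (xs : List A) (f g : A → Carrier) → ∑ xs (λ x → f x + g x) ≈ ∑ xs f + ∑ xs g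
  ∑-+ []       f g = ≈-sym (+-identityˡ 0#)
  ∑-+ (x ∷ xs) f g = ≈-trans (+-congˡ (∑-+ xs f g)) (interchange (f x) (g x) _ _)

  ∑-*ˡ : ∀ (xs : List A) k (f : A → Carrier) → k * ∑ xs f ≈ ∑ xs (λ x → k * f x)
  ∑-*ˡ []       k f = zeroʳ k
  ∑-*ˡ (x ∷ xs) k f = ≈-trans (distribˡ k _ _) (+-congˡ (∑-*ˡ xs k f))

  ∑-*ʳ : ∀ (xs : List A) k (f : A → Carrier) → ∑ xs f * k ≈ ∑ xs (λ x → f x * k)
  ∑-*ʳ xs k f = ≈-trans (*-comm _ k) (≈-trans (∑-*ˡ xs k f) (∑-cong xs λ x → *-comm k (f x)))

  ∑-neg : ∀ (xs : List A) (f : A → Carrier) → ∑ xs (λ x → - f x) ≈ - ∑ xs f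
  ∑-neg []       f = ≈-sym -0#≈0#
  ∑-neg (x ∷ xs) f = ≈-trans (+-congˡ (∑-neg xs f)) (-‿+-comm (f x) _)

  ∑-++ : ∀ (xs ys : List A) (f : A → Carrier) → ∑ (xs ++ ys) f ≈ ∑ xs f + ∑ ys f
  ∑-++ []       ys f = ≈-sym (+-identityˡ _)
  ∑-++ (x ∷ xs) ys f = ≈-trans (+-congˡ (∑-++ xs ys f)) (≈-sym (+-assoc _ _ _))

  ∑-comm : (xs : List A) (ys : List B) (f : A → B → Carrier) →
           ∑ xs (λ x → ∑ ys (f x)) ≈ ∑ ys (λ y → ∑ xs (λ x → f x y))
  ∑-comm []       ys f = ≈-sym (∑-zero ys)
  ∑-comm (x ∷ xs) ys f = ≈-trans (+-congˡ (∑-comm xs ys f)) (≈-sym (∑-+ ys (f x) _))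

  ∑-concatMap : (g : A → List B) (xs : List A) (f : B → Carrier) →
                ∑ (concatMap g xs) f ≈ ∑ xs (λ x → ∑ (g x) f)
  ∑-concatMap g []       f = ≈-refl
  ∑-concatMap g (x ∷ xs) f = ≈-trans (∑-++ (g x) (concatMap g xs) f) (+-congˡ (∑-concatMap g xs f))

  ∑-map : ∀ (g : A → B) (xs : List A) (f : B → Carrier) →
          ∑ (mapᴸ g xs) f ≡ ∑ xs (f ∘ g)
  ∑-map g []       f = refl
  ∑-map g (x ∷ xs) f = cong (f (g x) +_) (∑-map g xs f)

  𝟙-∧ : ∀ a b x → 𝟙[ a ∧ b ] x ≡ 𝟙[ a ] 𝟙[ b ] x
  𝟙-∧ true  b x = refl
  𝟙-∧ false b x = refl

  𝟙-cong : ∀ {a b x y} → a ≡ b → x ≈ y → 𝟙[ a ] x ≈ 𝟙[ b ] y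
  𝟙-cong {true}  refl eq = eq
  𝟙-cong {false} refl eq = ≈-refl

  𝟙-*ˡ : ∀ b x y → x * 𝟙[ b ] y ≈ 𝟙[ b ] (x * y)
  𝟙-*ˡ true  x y = ≈-refl
  𝟙-*ˡ false x y = zeroʳ x

  𝟙-*ʳ : ∀ b x y → 𝟙[ b ] x * y ≈ 𝟙[ b ] (x * y)
  𝟙-*ʳ true  x y = ≈-refl
  𝟙-*ʳ false x y = zeroˡ y

  𝟙-*-𝟙 : ∀ a b x y → 𝟙[ a ] x * 𝟙[ b ] y ≈ 𝟙[ a ∧ b ] (x * y)
  𝟙-*-𝟙 true  b x y = 𝟙-*ˡ b x y
  𝟙-*-𝟙 false b x y = zeroˡ _

  𝟙-neg : ∀ b x → 𝟙[ b ] (- x) ≈ - 𝟙[ b ] x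
  𝟙-neg true  x = ≈-refl
  𝟙-neg false x = ≈-sym -0#≈0#

  𝟙-split : ∀ b x → x ≈ 𝟙[ b ] x + 𝟙[ not b ] x
  𝟙-split true  x = ≈-sym (+-identityʳ x)
  𝟙-split false x = ≈-sym (+-identityˡ x)

  𝟙-comm : ∀ a b x → 𝟙[ a ] 𝟙[ b ] x ≡ 𝟙[ b ] 𝟙[ a ] x
  𝟙-comm true  b x = refl
  𝟙-comm false true  x = refl
  𝟙-comm false false x = refl

  𝟙-zero : ∀ b → 𝟙[ b ] 0# ≈ 0#
  𝟙-zero true  = ≈-refl
  𝟙-zero false = ≈-refl

  𝟙-∧-1# : ∀ a b → 𝟙[ a ∧ b ] 1# ≈ 𝟙[ a ] 1# * 𝟙[ b ] 1#
  𝟙-∧-1# a b = ≈-sym (≈-trans (𝟙-*-𝟙 a b 1# 1#) (𝟙-cong refl (*-identityˡ 1#)))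

  𝟙-*-𝟙1# : ∀ a b x → 𝟙[ a ] (x * 𝟙[ b ] 1#) ≈ 𝟙[ a ∧ b ] x
  𝟙-*-𝟙1# a b x = begin
    𝟙[ a ] (x * 𝟙[ b ] 1#)  ≈⟨ 𝟙-cong refl (𝟙-*ˡ b x 1#) ⟩
    𝟙[ a ] 𝟙[ b ] (x * 1#)  ≡⟨ 𝟙-∧ a b _ ⟨
    𝟙[ a ∧ b ] (x * 1#)     ≈⟨ 𝟙-cong refl (*-identityʳ x) ⟩
    𝟙[ a ∧ b ] x            ∎

  𝟙-guard : ∀ {A : Set a} (a? : Dec A) {x y} → (A → x ≈ y) → 𝟙[ does a? ] x ≈ 𝟙[ does a? ] y
  𝟙-guard (yes a) eq = eq a
  𝟙-guard (no _)  eq = ≈-refl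

  𝟙-⇔ : ∀ {A : Set a} {B : Set b} → A ⇔ B → (a? : Dec A) (b? : Dec B) → ∀ {x y} → x ≈ y →
        𝟙[ does a? ] x ≈ 𝟙[ does b? ] y
  𝟙-⇔ A⇔B a? b? = 𝟙-cong (does-⇔ A⇔B a? b?)

  ∑-𝟙 : ∀ (xs : List A) b (f : A → Carrier) → ∑ xs (λ x → 𝟙[ b ] f x) ≈ 𝟙[ b ] ∑ xs f
  ∑-𝟙 xs true  f = ≈-refl
  ∑-𝟙 xs false f = ∑-zero xs

  record Enumerates {A : Set a} (_≟ₐ_ : DecidableEquality A) (xs : List A) : Set (a ⊔ c ⊔ ℓ) where
    field
      ∑-select : ∀ (f : A → Carrier) y → ∑ xs (λ x → 𝟙[ does (x ≟ₐ y) ] f x) ≈ f y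

  open Enumerates public

  Bool-enumerates : Enumerates _≟ᵇ_ (true ∷ false ∷ [])
  Bool-enumerates .∑-select f true  = ≈-trans (+-congˡ (+-identityˡ 0#)) (+-identityʳ _)
  Bool-enumerates .∑-select f false = ≈-trans (+-identityˡ _) (+-identityʳ _)

  allVecs-enumerates : ∀ {a} {A : Set a} {_≟ₐ_ : DecidableEquality A} {xs} →
                       Enumerates _≟ₐ_ xs → ∀ n → Enumerates (≡-dec _≟ₐ_) (allVecs xs n)
  allVecs-enumerates enum zero    .∑-select f []       = +-identityʳ _
  allVecs-enumerates {_≟ₐ_ = _≟ₐ_} {xs} enum (suc n) .∑-select f (y ∷ ys) = begin
    ∑ (allVecs xs (suc n)) (λ v → 𝟙[ does (≡-dec _≟ₐ_ v (y ∷ ys)) ] f v)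
      ≈⟨ ∑-concatMap _ xs _ ⟩
    ∑ xs (λ x → ∑ (mapᴸ (x ∷_) (allVecs xs n)) (λ v → 𝟙[ does (≡-dec _≟ₐ_ v (y ∷ ys)) ] f v))
      ≈⟨ ∑-cong xs (λ x → ≈-reflexive (∑-map (x ∷_) (allVecs xs n) _)) ⟩
    ∑ xs (λ x → ∑ (allVecs xs n) (λ zs → 𝟙[ does (x ≟ₐ y) ∧ does (≡-dec _≟ₐ_ zs ys) ] f (x ∷ zs)))
      ≈⟨ ∑-cong xs (λ x → ∑-cong (allVecs xs n) λ zs → ≈-reflexive (𝟙-∧ (does (x ≟ₐ y)) _ _)) ⟩
    ∑ xs (λ x → ∑ (allVecs xs n) (λ zs → 𝟙[ does (x ≟ₐ y) ] 𝟙[ does (≡-dec _≟ₐ_ zs ys) ] f (x ∷ zs)))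
      ≈⟨ ∑-cong xs (λ x → ∑-𝟙 (allVecs xs n) (does (x ≟ₐ y)) _) ⟩
    ∑ xs (λ x → 𝟙[ does (x ≟ₐ y) ] ∑ (allVecs xs n) (λ zs → 𝟙[ does (≡-dec _≟ₐ_ zs ys) ] f (x ∷ zs)))
      ≈⟨ ∑-cong xs (λ x → 𝟙-cong refl (∑-select (allVecs-enumerates enum n) (λ zs → f (x ∷ zs)) ys)) ⟩
    ∑ xs (λ x → 𝟙[ does (x ≟ₐ y) ] f (x ∷ ys))
      ≈⟨ ∑-select enum (λ x → f (x ∷ ys)) y ⟩
    f (y ∷ ys) ∎

  module _ {a} {A : Set a} {_≟ₐ_ : DecidableEquality A} {xs : List A} (enum : Enumerates _≟ₐ_ xs)
           (h : A → A) (h-involutive : ∀ x → h (h x) ≡ x) where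

    ∑-reindex : ∀ (f : A → Carrier) → ∑ xs (f ∘ h) ≈ ∑ xs f
    ∑-reindex f = begin
      ∑ xs (λ x → f (h x))
        ≈⟨ ∑-cong xs (λ x → ≈-sym (∑-select enum f (h x))) ⟩
      ∑ xs (λ x → ∑ xs (λ y → 𝟙[ does (y ≟ₐ h x) ] f y))
        ≈⟨ ∑-comm xs xs _ ⟩
      ∑ xs (λ y → ∑ xs (λ x → 𝟙[ does (y ≟ₐ h x) ] f y))
        ≈⟨ ∑-cong xs (λ y → ∑-cong xs λ x → 𝟙-⇔ (swap-h y x) (y ≟ₐ h x) (x ≟ₐ h y) ≈-refl) ⟩
      ∑ xs (λ y → ∑ xs (λ x → 𝟙[ does (x ≟ₐ h y) ] f y))
        ≈⟨ ∑-cong xs (λ y → ∑-select enum (λ _ → f y) (h y)) ⟩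
      ∑ xs f ∎
      where
      swap-h : ∀ y x → (y ≡ h x) ⇔ (x ≡ h y)
      swap-h y x = mk⇔ (λ y≡hx → trans (sym (h-involutive x)) (cong h (sym y≡hx)))
                       (λ x≡hy → trans (sym (h-involutive y)) (cong h (sym x≡hy)))

    -- Cancelling the p-half against the (not ∘ p)-half avoids dividing by 2, so any characteristic works.
    ∑-sign-reversing : ∀ (f : A → Carrier) (p : A → Bool) →
                       (∀ x → p (h x) ≡ not (p x)) → (∀ x → f (h x) ≈ - f x) → ∑ xs f ≈ 0#
    ∑-sign-reversing f p p-flips f-flips = begin
      ∑ xs f
        ≈⟨ ∑-cong xs (λ x → 𝟙-split (p x) (f x)) ⟩
      ∑ xs (λ x → 𝟙[ p x ] f x + 𝟙[ not (p x) ] f x)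
        ≈⟨ ∑-+ xs _ _ ⟩
      ∑ xs (λ x → 𝟙[ p x ] f x) + rest
        ≈⟨ +-congʳ (∑-reindex (λ x → 𝟙[ p x ] f x)) ⟨
      ∑ xs (λ x → 𝟙[ p (h x) ] f (h x)) + rest
        ≈⟨ +-congʳ (∑-cong xs λ x → 𝟙-cong (p-flips x) (f-flips x)) ⟩
      ∑ xs (λ x → 𝟙[ not (p x) ] (- f x)) + rest
        ≈⟨ +-congʳ (≈-trans (∑-cong xs λ x → 𝟙-neg (not (p x)) (f x)) (∑-neg xs _)) ⟩
      - rest + rest
        ≈⟨ -‿inverseˡ rest ⟩
      0# ∎
      where rest = ∑ xs (λ x → 𝟙[ not (p x) ] f x)

module SelfDuality {c ℓ} (𝕂 : Field c ℓ) where

  open Field 𝕂 renaming (refl to ≈-refl; sym to ≈-sym; trans to ≈-trans; reflexive to ≈-reflexive)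
  open ListSum commutativeRing
  open import Algebra.Properties.Ring ring using (-‿involutive; -1*x≈-x)
  open import Algebra.Properties.CommutativeSemigroup *-commutativeSemigroup using (x∙yz≈xz∙y)
  open import Relation.Binary.Reasoning.Setoid setoid

  sgn : ∀ {n} → EdgeSet n → Carrier
  sgn L = if parityᴱ L then - 1# else 1#

  sgn-∅ᴱ : ∀ {n} → sgn (∅ᴱ {n}) ≡ 1#
  sgn-∅ᴱ {n} rewrite parityᴱ-∅ᴱ {n} = refl

  sgn-⊕ᴱ-pairᴱ : ∀ {n} {a b : Fin n} (L : EdgeSet n) → a < b → sgn (L ⊕ᴱ pairᴱ a b) ≈ - sgn L
  sgn-⊕ᴱ-pairᴱ L a<b rewrite parityᴱ-⊕ᴱ-pairᴱ L a<b with parityᴱ L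
  ... | true  = ≈-sym (-‿involutive 1#)
  ... | false = ≈-refl

  sgn-sq : ∀ {n} (L : EdgeSet n) → sgn L * sgn L ≈ 1#
  sgn-sq L with parityᴱ L
  ... | true  = ≈-trans (-1*x≈-x (- 1#)) (-‿involutive 1#)
  ... | false = *-identityˡ 1#

  allEdgeSets-enumerates : ∀ n → Enumerates _≟ᴱ_ (allEdgeSets n)
  allEdgeSets-enumerates n = allVecs-enumerates (allVecs-enumerates Bool-enumerates n) n

  -- Unfolds definitionally to ∑ (allEdgeSets n) (λ L → 𝟙[ does (isMatching? G L) ] f L).
  ∑ᴹ : ∀ {n} → Graph n → (EdgeSet n → Carrier) → Carrier
  ∑ᴹ = sumOver 𝕂 IsMatching isMatching?

  module _ {n} (G : Graph n) where

    private all = allEdgeSets n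

    ∑ᴹ-cong : ∀ {f g} → (∀ L → IsMatching G L → f L ≈ g L) → ∑ᴹ G f ≈ ∑ᴹ G g
    ∑ᴹ-cong eq = ∑-cong all λ L → 𝟙-guard (isMatching? G L) (eq L)

    ∑ᴹ-*ˡ : ∀ k f → k * ∑ᴹ G f ≈ ∑ᴹ G (λ L → k * f L)
    ∑ᴹ-*ˡ k f = ≈-trans (∑-*ˡ all k _) (∑-cong all λ L → 𝟙-*ˡ (does (isMatching? G L)) k (f L))

    ∑ᴹ-*ʳ : ∀ k f → ∑ᴹ G f * k ≈ ∑ᴹ G (λ L → f L * k)
    ∑ᴹ-*ʳ k f = ≈-trans (∑-*ʳ all k _) (∑-cong all λ L → 𝟙-*ʳ (does (isMatching? G L)) (f L) k)

    ∑ᴹ-𝟙-*ˡ : ∀ b k f → ∑ᴹ G (λ L → 𝟙[ b ] (k * f L)) ≈ 𝟙[ b ] (k * ∑ᴹ G f)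
    ∑ᴹ-𝟙-*ˡ true  k f = ≈-sym (∑ᴹ-*ˡ k f)
    ∑ᴹ-𝟙-*ˡ false k f = ≈-trans (∑-cong all λ L → 𝟙-zero (does (isMatching? G L))) (∑-zero all)

    ∑ᴹ-comm : ∀ (f : EdgeSet n → EdgeSet n → Carrier) →
              ∑ᴹ G (λ L → ∑ᴹ G (f L)) ≈ ∑ᴹ G (λ M → ∑ᴹ G (λ L → f L M))
    ∑ᴹ-comm f = begin
      ∑ all (λ L → 𝟙[ m L ] ∑ all (λ M → 𝟙[ m M ] f L M))
        ≈⟨ ∑-cong all (λ L → ∑-𝟙 all (m L) _) ⟨
      ∑ all (λ L → ∑ all (λ M → 𝟙[ m L ] 𝟙[ m M ] f L M))
        ≈⟨ ∑-comm all all _ ⟩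
      ∑ all (λ M → ∑ all (λ L → 𝟙[ m L ] 𝟙[ m M ] f L M))
        ≈⟨ ∑-cong all (λ M → ∑-cong all λ L → ≈-reflexive (𝟙-comm (m L) (m M) _)) ⟩
      ∑ all (λ M → ∑ all (λ L → 𝟙[ m M ] 𝟙[ m L ] f L M))
        ≈⟨ ∑-cong all (λ M → ∑-𝟙 all (m M) _) ⟩
      ∑ all (λ M → 𝟙[ m M ] ∑ all (λ L → 𝟙[ m L ] f L M)) ∎
      where
      m : EdgeSet n → Bool
      m L = does (isMatching? G L)

    ∑-sgn-between-cancels : ∀ K X {a b} → IsMatching G X → Symmetric K →
                            a < b → X ⟦ a , b ⟧ ≡ true → K ⟦ a , b ⟧ ≡ false →
                            ∑ all (λ L → 𝟙[ does (between? G K X L) ] sgn L) ≈ 0#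
    ∑-sgn-between-cancels K X {a} {b} mX@((_ , symX) , _) symK a<b xab kab =
      ∑-sign-reversing (allEdgeSets-enumerates n) (_⊕ᴱ E) (λ L → ⊕ᴱ-involutive L E) _ (_⟦ a , b ⟧)
        (λ L → ⊕ᴱ-lookup-on L E (pairᴱ-ab {a = a} {b}))
        (λ L → ≈-trans (𝟙-⇔ (toggle⇔ L) (between? G K X (L ⊕ᴱ E)) (between? G K X L) (sgn-⊕ᴱ-pairᴱ L a<b))
                       (𝟙-neg _ (sgn L)))
      where
      E = pairᴱ a b
      toggle : ∀ {L} → Between G K X L → Between G K X (L ⊕ᴱ E)
      toggle {L} = Between-⊕ᴱ G {K} {X} {E} {L} mX
        (pairᴱ-⊆ᴱ {X = X} symX xab) (pairᴱ-sym {a = a} {b}) (pairᴱ-disjoint {K = K} symK kab)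
      toggle⇔ : ∀ L → Between G K X (L ⊕ᴱ E) ⇔ Between G K X L
      toggle⇔ L = mk⇔ (subst (Between G K X) (⊕ᴱ-involutive L E) ∘ toggle {L ⊕ᴱ E}) (toggle {L})

    ∑-sgn-interval : ∀ K X → IsMatching G X → Symmetric K →
                     ∑ᴹ G (λ L → 𝟙[ does (K ⊆ᴱ? L ×-dec L ⊆ᴱ? X) ] sgn L) ≈ 𝟙[ does (K ≟ᴱ X) ] sgn K
    ∑-sgn-interval K X mX@((X⊆G , symX) , _) symK =
      ≈-trans (∑-cong all λ L → ≈-reflexive (sym (𝟙-∧ (does (isMatching? G L)) _ (sgn L)))) by-cases
      where
      by-cases : ∑ all (λ L → 𝟙[ does (between? G K X L) ] sgn L) ≈ 𝟙[ does (K ≟ᴱ X) ] sgn K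
      by-cases with K ≟ᴱ X
      ... | yes refl = ≈-trans (∑-cong all λ L → 𝟙-⇔ (only-K L) (between? G K K L) (L ≟ᴱ K) ≈-refl)
                               (∑-select (allEdgeSets-enumerates n) sgn K)
        where
        only-K : ∀ L → Between G K K L ⇔ L ≡ K
        only-K L = mk⇔ (λ (_ , K⊆L , L⊆K) → ⊆ᴱ-antisym {A = L} {K} L⊆K K⊆L)
                       λ { refl → mX , (λ _ _ e → e) , (λ _ _ e → e) }
      ... | no K≢X with K ⊆ᴱ? X
      ...   | no K⊈X =
        ≈-trans (∑-cong all λ L → 𝟙-cong (dec-false (between? G K X L) (outside L)) ≈-refl) (∑-zero all)
        where
        outside : ∀ L → ¬ Between G K X L
        outside L (_ , K⊆L , L⊆X) = K⊈X (⊆ᴱ-trans {A = K} {L} {X} K⊆L L⊆X)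
      ...   | yes K⊆X with ¬⊆ᴱ⇒witness {K = X} {K} (K≢X ∘ ⊆ᴱ-antisym {A = K} {X} K⊆X)
      ...     | u , v , xuv , kuv with <-cmp u v
      ...       | tri< u<v _ _  = ∑-sgn-between-cancels K X mX symK u<v xuv kuv
      ...       | tri> _ _ v<u  = ∑-sgn-between-cancels K X mX symK v<u (trans (symX v u) xuv) (trans (symK v u) kuv)
      ...       | tri≈ _ refl _ = contradiction (trans (sym (adj-irr G u)) (X⊆G u u xuv)) λ ()

    ∑-sgn-disjoint-⊆ᴱ : ∀ F M → Symmetric F → IsMatching G M →
                        ∑ᴹ G (λ L → 𝟙[ does (disjointᴱ? F L ×-dec L ⊆ᴱ? M) ] sgn L)
                          ≈ 𝟙[ does (M ⊆ᴱ? F) ] 1#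
    ∑-sgn-disjoint-⊆ᴱ F M symF mM@((M⊆G , symM) , _) = begin
      ∑ᴹ G (λ L → 𝟙[ does (disjointᴱ? F L ×-dec L ⊆ᴱ? M) ] sgn L)
        ≈⟨ ∑-cong all (λ L → 𝟙-guard (isMatching? G L) λ _ →
             𝟙-⇔ (below-M∖F L) (disjointᴱ? F L ×-dec L ⊆ᴱ? M) (∅ᴱ ⊆ᴱ? L ×-dec L ⊆ᴱ? M ∖ᴱ F)
                 ≈-refl) ⟩
      ∑ᴹ G (λ L → 𝟙[ does (∅ᴱ ⊆ᴱ? L ×-dec L ⊆ᴱ? M ∖ᴱ F) ] sgn L)
        ≈⟨ ∑-sgn-interval ∅ᴱ (M ∖ᴱ F) M∖F-matching (∅ᴱ-sym {n}) ⟩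
      𝟙[ does (∅ᴱ ≟ᴱ M ∖ᴱ F) ] sgn (∅ᴱ {n})
        ≈⟨ 𝟙-⇔ (∅ᴱ≡∖ᴱ⇔⊆ᴱ {M = M} {F}) (∅ᴱ ≟ᴱ M ∖ᴱ F) (M ⊆ᴱ? F)
               (≈-reflexive (sgn-∅ᴱ {n})) ⟩
      𝟙[ does (M ⊆ᴱ? F) ] 1# ∎
      where
      M∖F-matching : IsMatching G (M ∖ᴱ F)
      M∖F-matching = ⊆ᴱ-matching G {M} {M ∖ᴱ F} mM (∖ᴱ-⊆ᴱ {M = M} {F}) (∖ᴱ-sym {M = M} {F} symM symF)
      below-M∖F : ∀ L → (Disjointᴱ F L × L ⊆ᴱ M) ⇔ (∅ᴱ ⊆ᴱ L × L ⊆ᴱ M ∖ᴱ F)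
      below-M∖F L = mk⇔ (λ p → ∅ᴱ-⊆ᴱ {L = L} , Equivalence.to (⊆ᴱ-∖ᴱ⇔ {F = F} {L} {M}) p)
                        (Equivalence.from (⊆ᴱ-∖ᴱ⇔ {F = F} {L} {M}) ∘ proj₂)

  disjointness : Matrix 𝕂
  disjointness G F K = 𝟙[ does (disjointᴱ? F K) ] 1#

  disjointness⁻¹ : Matrix 𝕂
  disjointness⁻¹ G F K = ∑ᴹ G (λ M → 𝟙[ does (F ⊆ᴱ? M ×-dec K ⊆ᴱ? M) ] (sgn M * (sgn F * sgn K)))

  disjointness-sym : ∀ {n} (G : Graph n) F K → disjointness G F K ≈ disjointness G K F
  disjointness-sym G F K =
    𝟙-⇔ (mk⇔ (Disjointᴱ-sym {F = F} {K}) (Disjointᴱ-sym {F = K} {F})) (disjointᴱ? F K) (disjointᴱ? K F) ≈-refl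

  disjointness⁻¹-sym : ∀ {n} (G : Graph n) F K → disjointness⁻¹ G F K ≈ disjointness⁻¹ G K F
  disjointness⁻¹-sym {n} G F K = ∑-cong (allEdgeSets n) λ M → 𝟙-guard (isMatching? G M) λ _ →
    𝟙-⇔ (mk⇔ swap swap) (F ⊆ᴱ? M ×-dec K ⊆ᴱ? M) (K ⊆ᴱ? M ×-dec F ⊆ᴱ? M)
        (*-congˡ (*-comm (sgn F) (sgn K)))

  δ-sym : ∀ {n} (F K : EdgeSet n) → δ 𝕂 F K ≈ δ 𝕂 K F
  δ-sym F K = 𝟙-⇔ (mk⇔ sym sym) (F ≟ᴱ K) (K ≟ᴱ F) ≈-refl

  disjointness-inverseˡ : ∀ {n} (G : Graph n) F F″ → IsMatching G F → IsMatching G F″ →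
    ∑ᴹ G (λ F′ → disjointness G F F′ * disjointness⁻¹ G F′ F″) ≈ δ 𝕂 F F″
  disjointness-inverseˡ {n} G F F″ mF mF″ = begin
    ∑ᴹ G (λ F′ → disjointness G F F′ * disjointness⁻¹ G F′ F″)
      ≈⟨ ∑-cong all (λ F′ → 𝟙-guard (isMatching? G F′) λ _ →
           ≈-trans (∑ᴹ-*ˡ G _ _) (∑-cong all λ M → 𝟙-guard (isMatching? G M) λ _ → rearrange _ _ _ _ _ _)) ⟩
    ∑ᴹ G (λ F′ → ∑ᴹ G (λ M → 𝟙[ F″⊆ M ] (sgn M * sgn F″ * 𝟙[ does (below M F′) ] sgn F′)))
      ≈⟨ ∑ᴹ-comm G _ ⟩
    ∑ᴹ G (λ M → ∑ᴹ G (λ F′ → 𝟙[ F″⊆ M ] (sgn M * sgn F″ * 𝟙[ does (below M F′) ] sgn F′)))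
      ≈⟨ ∑ᴹ-cong G (λ M mM → ≈-trans (∑ᴹ-𝟙-*ˡ G (F″⊆ M) _ _)
                                    (𝟙-cong refl (*-congˡ (∑-sgn-disjoint-⊆ᴱ G F M symF mM)))) ⟩
    ∑ᴹ G (λ M → 𝟙[ F″⊆ M ] (sgn M * sgn F″ * 𝟙[ does (M ⊆ᴱ? F) ] 1#))
      ≈⟨ ∑-cong all (λ M → 𝟙-guard (isMatching? G M) λ _ → merge-guards M) ⟩
    ∑ᴹ G (λ M → 𝟙[ does (F″ ⊆ᴱ? M ×-dec M ⊆ᴱ? F) ] sgn M * sgn F″)
      ≈⟨ ∑ᴹ-*ʳ G (sgn F″) _ ⟨
    ∑ᴹ G (λ M → 𝟙[ does (F″ ⊆ᴱ? M ×-dec M ⊆ᴱ? F) ] sgn M) * sgn F″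
      ≈⟨ *-congʳ (∑-sgn-interval G F″ F mF symF″) ⟩
    𝟙[ does (F″ ≟ᴱ F) ] sgn F″ * sgn F″
      ≈⟨ ≈-trans (𝟙-*ʳ (does (F″ ≟ᴱ F)) _ _) (𝟙-cong refl (sgn-sq F″)) ⟩
    δ 𝕂 F″ F
      ≈⟨ δ-sym F″ F ⟩
    δ 𝕂 F F″ ∎
    where
    all = allEdgeSets n
    symF = proj₂ (proj₁ mF)
    symF″ = proj₂ (proj₁ mF″)
    F″⊆_ : EdgeSet n → Bool
    F″⊆ M = does (F″ ⊆ᴱ? M)
    below : ∀ M F′ → Dec (Disjointᴱ F F′ × F′ ⊆ᴱ M)
    below M F′ = disjointᴱ? F F′ ×-dec F′ ⊆ᴱ? M
    rearrange : ∀ d a b m f f′ →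
                𝟙[ d ] 1# * 𝟙[ a ∧ b ] (m * (f * f′)) ≈ 𝟙[ b ] (m * f′ * 𝟙[ d ∧ a ] f)
    rearrange d a b m f f′ = begin
      𝟙[ d ] 1# * 𝟙[ a ∧ b ] (m * (f * f′))
        ≈⟨ 𝟙-*-𝟙 d (a ∧ b) 1# _ ⟩
      𝟙[ d ∧ (a ∧ b) ] (1# * (m * (f * f′)))
        ≈⟨ 𝟙-cong guards (≈-trans (*-identityˡ _) (x∙yz≈xz∙y m f f′)) ⟩
      𝟙[ b ∧ (d ∧ a) ] (m * f′ * f)
        ≡⟨ 𝟙-∧ b (d ∧ a) _ ⟩
      𝟙[ b ] 𝟙[ d ∧ a ] (m * f′ * f)
        ≈⟨ 𝟙-cong refl (𝟙-*ˡ (d ∧ a) (m * f′) f) ⟨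
      𝟙[ b ] (m * f′ * 𝟙[ d ∧ a ] f) ∎
      where
      guards : d ∧ (a ∧ b) ≡ b ∧ (d ∧ a)
      guards = trans (sym (∧-assoc d a b)) (∧-comm (d ∧ a) b)
    merge-guards : ∀ M → 𝟙[ F″⊆ M ] (sgn M * sgn F″ * 𝟙[ does (M ⊆ᴱ? F) ] 1#)
                         ≈ 𝟙[ does (F″ ⊆ᴱ? M ×-dec M ⊆ᴱ? F) ] sgn M * sgn F″
    merge-guards M = ≈-trans (𝟙-*-𝟙1# (F″⊆ M) (does (M ⊆ᴱ? F)) _) (≈-sym (𝟙-*ʳ _ (sgn M) (sgn F″)))

  disjointness-inverseʳ : ∀ {n} (G : Graph n) F F″ → IsMatching G F → IsMatching G F″ →
    ∑ᴹ G (λ F′ → disjointness⁻¹ G F F′ * disjointness G F′ F″) ≈ δ 𝕂 F F″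
  disjointness-inverseʳ {n} G F F″ mF mF″ = begin
    ∑ᴹ G (λ F′ → disjointness⁻¹ G F F′ * disjointness G F′ F″)
      ≈⟨ ∑-cong (allEdgeSets n) (λ F′ → 𝟙-guard (isMatching? G F′) λ _ →
           ≈-trans (*-comm _ _) (*-cong (disjointness-sym G F′ F″) (disjointness⁻¹-sym G F F′))) ⟩
    ∑ᴹ G (λ F′ → disjointness G F″ F′ * disjointness⁻¹ G F′ F)
      ≈⟨ disjointness-inverseˡ G F″ F mF″ mF ⟩
    δ 𝕂 F″ F
      ≈⟨ δ-sym F″ F ⟩
    δ 𝕂 F F″ ∎

  disjointness-transport : ∀ {n n′} {G : Graph n} {G′ : Graph n′} (i : Iso G G′) F K → F ⊆ᴱ adj G →
                           disjointness G′ (transport i F) (transport i K) ≈ disjointness G F K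
  disjointness-transport i F K F⊆G =
    𝟙-⇔ (transport-disjoint⇔ i {F} {K} F⊆G) (disjointᴱ? (transport i F) (transport i K)) (disjointᴱ? F K)
        ≈-refl

  disjointness-⊔ᴱ : ∀ {n} (G : Graph n) (d : Decomp G) F H K →
                    F ⊆ᴱ adj (induced G (S d)) → H ⊆ᴱ adj (induced G (T d)) →
                    disjointness G (F ⊔ᴱ H) K
                      ≈ disjointness (induced G (S d)) F (K ∣ᴱ S d) * disjointness (induced G (T d)) H (K ∣ᴱ T d)
  disjointness-⊔ᴱ G d F H K F⊆G_S H⊆G_T =
    ≈-trans (𝟙-⇔ (⊔ᴱ-disjoint⇔ G {S d} {T d} {F} {H} {K} F⊆G_S H⊆G_T) (disjointᴱ? (F ⊔ᴱ H) K) both?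
                 ≈-refl)
            (𝟙-∧-1# (does (disjointᴱ? F (K ∣ᴱ S d))) (does (disjointᴱ? H (K ∣ᴱ T d))))
    where both? = disjointᴱ? F (K ∣ᴱ S d) ×-dec disjointᴱ? H (K ∣ᴱ T d)

  disjointness-isHopfIsoToDual : IsHopfIsoToDual 𝕂 IsMatching isMatching? disjointness
  disjointness-isHopfIsoToDual = record
    { natural    = λ G G′ i F K mF _ → disjointness-transport i F K (proj₁ (proj₁ mF))
    ; invertible = disjointness⁻¹ , disjointness-inverseˡ , disjointness-inverseʳ
    ; unit       = λ {n} G _ → 𝟙-cong (dec-true (disjointᴱ? (∅ᴱ {n}) ∅ᴱ) λ u v e _ → ∅ᴱ-empty u v e) ≈-refl
    ; product    = λ G d F H K mF mH _ → disjointness-⊔ᴱ G d F H K (proj₁ (proj₁ mF)) (proj₁ (proj₁ mH))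
    ; coproduct  = λ G d K F H _ mF mH →
        let G_S = induced G (S d); G_T = induced G (T d) in begin
        disjointness G K (F ⊔ᴱ H)
          ≈⟨ disjointness-sym G K (F ⊔ᴱ H) ⟩
        disjointness G (F ⊔ᴱ H) K
          ≈⟨ disjointness-⊔ᴱ G d F H K (proj₁ (proj₁ mF)) (proj₁ (proj₁ mH)) ⟩
        disjointness G_S F (K ∣ᴱ S d) * disjointness G_T H (K ∣ᴱ T d)
          ≈⟨ *-cong (disjointness-sym G_S F (K ∣ᴱ S d)) (disjointness-sym G_T H (K ∣ᴱ T d)) ⟩
        disjointness G_S (K ∣ᴱ S d) F * disjointness G_T (K ∣ᴱ T d) H ∎
    }

mainTheorem12 : ∀ {c ℓ : Level} (K : Field c ℓ) →
    IsHopfSubmonoidOfFL IsMatching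
    × IsCommutative IsMatching
    × IsCocommutative IsMatching
    × ∃ (λ (φ : Matrix K) → IsHopfIsoToDual K IsMatching isMatching? φ)
mainTheorem12 K =
    matchings-hopfSubmonoid
  , (λ G d F H _ _ → ⊔ᴱ-comm F H)
  , (λ G d F _ → refl)
  , disjointness , disjointness-isHopfIsoToDual
  where open SelfDuality K
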